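{- For any tensor $T\in\mathbb{F}^{n_1}\otimes\mathbb{F}^{n_2}\otimes\mathbb{F}^{n_3}$ and any distinct $i,j\in[3]$, we have $\rho_{i,j}(T)\leq\underline{Q}(T)$.
   Context: For a nonzero matrix $A\in\mathbb{F}^{m_1\times m_2}$, its pivot $p(A)$ is the lexicographically smallest $(a,b)$ with $A_{a,b}\neq0$. Every subspace $\mathcal{A}$ of $m_1\times m_2$ matrices has a basis with pairwise distinct pivots, and the set of these pivots, $p(\mathcal{A})$, does not depend on the basis. $\rho(\mathcal{A})$ is the smallest $|S_1|+|S_2|$ with $S_1\subseteq[m_1]$, $S_2\subseteq[m_2]$ and $p(\mathcal{A})\subseteq(S_1\times[m_2])\cup([m_1]\times S_2)$. For $T=\sum T_{a_1,a_2,a_3}e_{a_1}\otimes e_{a_2}\otimes e_{a_3}$ and distinct $i,j$ with $\ell$ the remaining index, $\mathcal{A}_{i,j}\subseteq\mathbb{F}^{n_i}\otimes\mathbb{F}^{n_j}$ is the span over $t\in[n_\ell]$ of the matrices with rows indexed by $a_i$, columns by $a_j$ and entries $T$'s coefficients with $a_\ell=t$; $\rho_{i,j}(T)=\rho(\mathcal{A}_{i,j})$. The border subrank $\underline{Q}(T)$ is the largest $r$ such that there are matrices $A(\varepsilon),B(\varepsilon),C(\varepsilon)$ with Laurent polynomial entries in a formal variable $\varepsilon$ such that $(A(\varepsilon)\otimes B(\varepsilon)\otimes C(\varepsilon))T=\langle r\rangle+\varepsilon S_1+\cdots+\varepsilon^tS_t$ for some tensors $S_1,\dots,S_t$ over $\mathbb{F}$,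 where $\langle r\rangle=\sum_{i=1}^re_i\otimes e_i\otimes e_i$. -}

module Defs where

open import Level using (Level; _⊔_)
open import Algebra.Bundles using (CommutativeRing)
open import Data.Nat as ℕ using (ℕ; zero; suc; _≤_; _<_)
open import Data.Integer as ℤ using (ℤ; +_; -[1+_])
open import Data.Fin as Fin using (Fin; zero; suc; toℕ)
open import Data.Fin.Subset using (Subset; _∈_; ∣_∣)
open import Data.List as List using (List; []; _∷_; _++_)
open import Data.Product using (Σ; ∃; _×_; _,_; proj₁; proj₂)
open import Data.Sum using (_⊎_)
open import Relation.Nullary using (¬_)
open import Relation.Binary.PropositionalEquality using (_≡_)
open import Function.Definitions using (Injective)

record Field (c ℓ : Level) : Set (Level.suc (c ⊔ ℓ)) where
  field
    commutativeRing : CommutativeRing c ℓ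
  open CommutativeRing commutativeRing public
  field
    1≉0     : ¬ (1# ≈ 0#)
    inverse : ∀ x → ¬ (x ≈ 0#) → Σ Carrier λ y → x * y ≈ 1#

module FieldDefs {c ℓ} (F : Field c ℓ) where
  open Field F using (Carrier; _≈_; _+_; _*_; 0#; 1#; +-monoid)

  open import Algebra.Properties.Monoid.Sum +-monoid using (sum)

  Matrix : ℕ → ℕ → Set c
  Matrix m₁ m₂ = Fin m₁ → Fin m₂ → Carrier

  Tensor : ℕ → ℕ → ℕ → Set c
  Tensor n₁ n₂ n₃ = Fin n₁ → Fin n₂ → Fin n₃ → Carrier

  _<lex_ : ∀ {m₁ m₂} → Fin m₁ × Fin m₂ → Fin m₁ × Fin m₂ → Set
  (a' , b') <lex (a , b) = (toℕ a' < toℕ a) ⊎ ((a' ≡ a) × (toℕ b' < toℕ b))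

  IsPivot : ∀ {m₁ m₂} → Matrix m₁ m₂ → Fin m₁ × Fin m₂ → Set (ℓ)
  IsPivot M (a , b) =
    ¬ (M a b ≈ 0#) ×
    (∀ a' b' → (a' , b') <lex (a , b) → M a' b' ≈ 0#)

  InSpan : ∀ {m₁ m₂ d} → (Fin d → Matrix m₁ m₂) → Matrix m₁ m₂ → Set (c ⊔ ℓ)
  InSpan {d = d} vs M =
    Σ (Fin d → Carrier) λ coef →
      ∀ a b → M a b ≈ sum (λ t → coef t * vs t a b)

  SameSpan : ∀ {m₁ m₂ d e} → (Fin d → Matrix m₁ m₂) → (Fin e → Matrix m₁ m₂)
           → Set (c ⊔ ℓ)
  SameSpan vs ws = (∀ k → InSpan ws (vs k)) × (∀ t → InSpan vs (ws t))

  -- A basis with pairwise distinct pivots of the subspace spanned by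
  -- the family `gens`.  (Distinct pivots imply linear independence.)
  record PivotBasis {m₁ m₂ e} (gens : Fin e → Matrix m₁ m₂) : Set (c ⊔ ℓ) where
    field
      dim      : ℕ
      basis    : Fin dim → Matrix m₁ m₂
      pivot    : Fin dim → Fin m₁ × Fin m₂
      isPivot  : ∀ k → IsPivot (basis k) (pivot k)
      distinct : Injective _≡_ _≡_ pivot
      spans    : SameSpan basis gens

  InPivotSet : ∀ {m₁ m₂ e} {gens : Fin e → Matrix m₁ m₂} → PivotBasis gens
             → Fin m₁ × Fin m₂ → Set
  InPivotSet B p = ∃ λ k → PivotBasis.pivot B k ≡ p

  Covers : ∀ {m₁ m₂ e} {gens : Fin e → Matrix m₁ m₂} → PivotBasis gens
         → Subset m₁ → Subset m₂ → Set
  Covers B S₁ S₂ = ∀ a b → InPivotSet B (a , b) → (a ∈ S₁) ⊎ (b ∈ S₂)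

  IsRho : ∀ {m₁ m₂ e} → (Fin e → Matrix m₁ m₂) → ℕ → Set (c ⊔ ℓ)
  IsRho {m₁} {m₂} gens r =
    Σ (PivotBasis gens) λ B →
      (Σ (Subset m₁) λ S₁ → Σ (Subset m₂) λ S₂ →
         Covers B S₁ S₂ × ∣ S₁ ∣ ℕ.+ ∣ S₂ ∣ ≡ r)
      × (∀ S₁ S₂ → Covers B S₁ S₂ → r ≤ ∣ S₁ ∣ ℕ.+ ∣ S₂ ∣)

  dimOf : ℕ → ℕ → ℕ → Fin 3 → ℕ
  dimOf n₁ n₂ n₃ zero = n₁
  dimOf n₁ n₂ n₃ (suc zero) = n₂
  dimOf n₁ n₂ n₃ (suc (suc zero)) = n₃

  -- the remaining index ℓ ∉ {i , j} (meaningless when i ≡ j)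
  third : Fin 3 → Fin 3 → Fin 3
  third zero (suc zero) = suc (suc zero)
  third zero (suc (suc zero)) = suc zero
  third (suc zero) zero = suc (suc zero)
  third (suc zero) (suc (suc zero)) = zero
  third (suc (suc zero)) zero = suc zero
  third (suc (suc zero)) (suc zero) = zero
  third _ _ = zero

  -- slice i j T t : the matrix with rows a_i, columns a_j, and entries
  -- T_{a₁a₂a₃} with a_ℓ = t  (the i ≡ j cases are never used)
  slice : ∀ {n₁ n₂ n₃} (i j : Fin 3) → Tensor n₁ n₂ n₃
        → Fin (dimOf n₁ n₂ n₃ (third i j))
        → Matrix (dimOf n₁ n₂ n₃ i) (dimOf n₁ n₂ n₃ j)
  slice zero (suc zero) T t a b = T a b t
  slice zero (suc (suc zero)) T t a b = T a t b
  slice (suc zero) zero T t a b = T b a t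
  slice (suc zero) (suc (suc zero)) T t a b = T t a b
  slice (suc (suc zero)) zero T t a b = T b t a
  slice (suc (suc zero)) (suc zero) T t a b = T t b a
  slice zero zero T t a b = 0#
  slice (suc zero) (suc zero) T t a b = 0#
  slice (suc (suc zero)) (suc (suc zero)) T t a b = 0#

  IsRhoIJ : ∀ {n₁ n₂ n₃} (i j : Fin 3) → Tensor n₁ n₂ n₃ → ℕ → Set (c ⊔ ℓ)
  IsRhoIJ i j T r = IsRho (slice i j T) r

  -- Laurent polynomials in ε over F.
  -- A pair (k , p) with p = p₀ ∷ p₁ ∷ … represents ε^{-k} · Σₘ pₘ εᵐ.

  Poly : Set c
  Poly = List Carrier

  padd : Poly → Poly → Poly
  padd [] q = q
  padd (x ∷ p) [] = x ∷ p
  padd (x ∷ p) (y ∷ q) = (x + y) ∷ padd p q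

  pscale : Carrier → Poly → Poly
  pscale x = List.map (x *_)

  pmul : Poly → Poly → Poly
  pmul [] q = []
  pmul (x ∷ p) q = padd (pscale x q) (0# ∷ pmul p q)

  pshift : ℕ → Poly → Poly
  pshift k p = List.replicate k 0# ++ p

  record Laurent : Set c where
    constructor laurent
    field
      negDeg : ℕ
      poly   : Poly

  ladd : Laurent → Laurent → Laurent
  ladd (laurent k p) (laurent l q) = laurent (k ℕ.+ l) (padd (pshift l p) (pshift k q))

  lmul : Laurent → Laurent → Laurent
  lmul (laurent k p) (laurent l q) = laurent (k ℕ.+ l) (pmul p q)

  lconst : Carrier → Laurent
  lconst x = laurent 0 (x ∷ [])

  lzero : Laurent
  lzero = laurent 0 []

  lsum : ∀ {n} → (Fin n → Laurent) → Laurent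
  lsum {zero} f = lzero
  lsum {suc n} f = ladd (f zero) (lsum (λ i → f (suc i)))

  pcoeff : Poly → ℕ → Carrier
  pcoeff [] m = 0#
  pcoeff (x ∷ p) zero = x
  pcoeff (x ∷ p) (suc m) = pcoeff p m

  lcoeff : Laurent → ℤ → Carrier
  lcoeff (laurent k p) e with e ℤ.+ (+ k)
  ... | + m = pcoeff p m
  ... | -[1+ _ ] = 0#

  LMatrix : ℕ → ℕ → Set c
  LMatrix m n = Fin m → Fin n → Laurent

  applyABC : ∀ {r n₁ n₂ n₃} → LMatrix r n₁ → LMatrix r n₂ → LMatrix r n₃
           → Tensor n₁ n₂ n₃ → Fin r → Fin r → Fin r → Laurent
  applyABC A B C T x y z =
    lsum λ a → lsum λ b → lsum λ c →
      lmul (A x a) (lmul (B y b) (lmul (C z c) (lconst (T a b c))))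

  unitTensor : ∀ r → Fin r → Fin r → Fin r → Carrier
  unitTensor r x y z with x Fin.≟ y | y Fin.≟ z
  ... | Relation.Nullary.yes _ | Relation.Nullary.yes _ = 1#
  ... | _ | _ = 0#

  -- (A ⊗ B ⊗ C) T = ⟨r⟩ + ε S₁ + ⋯ + ε^t S_t : no negative powers of ε,
  -- and the ε⁰ part is ⟨r⟩ (positive powers are arbitrary)
  BorderRestricts : ∀ {n₁ n₂ n₃} → Tensor n₁ n₂ n₃ → ℕ → Set (c ⊔ ℓ)
  BorderRestricts {n₁} {n₂} {n₃} T r =
    Σ (LMatrix r n₁) λ A → Σ (LMatrix r n₂) λ B → Σ (LMatrix r n₃) λ C →
      (∀ x y z → lcoeff (applyABC A B C T x y z) (+ 0) ≈ unitTensor r x y z)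
      × (∀ x y z (m : ℕ) → lcoeff (applyABC A B C T x y z) -[1+ m ] ≈ 0#)

  IsBorderSubrank : ∀ {n₁ n₂ n₃} → Tensor n₁ n₂ n₃ → ℕ → Set (c ⊔ ℓ)
  IsBorderSubrank T r = BorderRestricts T r × (∀ s → BorderRestricts T s → s ≤ r)

module Submission where

-- By König's theorem ρ(𝒜) is the largest number of pivots of 𝒜 no two of which share a row or a
-- column; König's theorem follows from the defect form of Hall's theorem, proved by induction on
-- the number of rows, splitting at a critical set when there is one.
-- Given such pivots (r_x , c_x), x < s, of matrices P_x = Σ_t w_{x,t} T(·,·,t) in 𝒜_{1,2}, write
-- ⌜a , b⌝ = n₂·a + b for the lexicographic rank of a position and put
--   A_x = ε^(n₂ r_x) e_{r_x},   B_y = ε^(c_y) e_{c_y},   C_z = ε^(−⌜r_z , c_z⌝) w_z / P_z(r_z , c_z).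
-- Then the (x , y , z) entry of (A ⊗ B ⊗ C) T is ε^(⌜r_x , c_y⌝ − ⌜r_z , c_z⌝) P_z(r_x , c_y) / P_z(r_z , c_z).
-- A negative exponent means that (r_x , c_y) precedes the pivot of P_z, where P_z vanishes, and a
-- zero exponent forces x = y = z because r and c are injective; so (A ⊗ B ⊗ C) T = ⟨s⟩ + O(ε)
-- and s ≤ Q̲(T). Every other slicing 𝒜_{i,j} is 𝒜_{1,2} of T with its factors permuted.

open import Defs
open import Level using (Level)
open import Data.Nat using (ℕ; _≤_)
open import Data.Fin using (Fin)
open import Relation.Binary.PropositionalEquality using (_≢_)

open import Data.Nat.Properties using (≤-trans)
open import Data.Fin using (zero; suc)
open import Data.Product using (_,_)
open import Function using (id; _∘_)
open import Relation.Nullary using (contradiction)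
open import Relation.Binary.PropositionalEquality using (refl)

module BipartiteMatching where
  open import Data.Bool using (true; false)
  open import Data.Nat using (zero; suc; _+_; _∸_; _<_; z≤n; _≤?_)
  open import Data.Nat.Properties
    using (≤-refl; ≤-trans; ≤-reflexive; ≤-pred; <-≤-trans; +-suc; +-assoc; +-comm; +-identityʳ;
           +-mono-≤; +-monoˡ-≤; +-monoʳ-≤; +-cancelʳ-≤; m≤n+m; m∸n+n≡m; ≤-<-trans; ≰⇒>;
           module ≤-Reasoning)
  open import Data.Fin using (zero; suc)
  open import Data.Fin.Properties using (any?)
  open import Data.Fin.Subset
    using (Subset; _∈_; _∉_; _⊆_; ∣_∣; ⊤; ⊥; ⁅_⁆; ∁; _∪_; _∩_; _─_; _-_; Nonempty)
  open import Data.Fin.Subset.Properties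
    using (_∈?_; _⊆?_; nonempty?; anySubset?; Empty-unique; ∣⊥∣≡0; ∣⊤∣≡n; ∣⁅x⁆∣≡1; ∣∁p∣≡n∸∣p∣;
           ∣p∣≤n; p⊆q⇒∣p∣≤∣q∣; ∣p∩q∣≤∣q∣; x∈p∪q⁺; x∈p∪q⁻; x∈p∩q⁺; p─q⊆p; x∈p∧x∉q⇒x∈p─q;
           x∈p∧x≢y⇒x∈p-y; x∈⁅x⁆; x∈⁅y⁆⇒x≡y; x∉p⇒x∈∁p; ∈⊤; ∉⊥; x∈p⇒∣p-x∣<∣p∣; p∩q≢∅⇒∣p─q∣<∣p∣)
  open import Data.Vec using ([]; _∷_; tabulate; there)
  open import Data.Vec.Properties using (lookup∘tabulate; []=⇒lookup; lookup⇒[]=)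
  open import Data.List using (List; []; _∷_; _++_; length; lookup)
  open import Data.List.Membership.Propositional.Properties using (∈-lookup)
  open import Data.List.Properties using (length-++)
  open import Data.List.Relation.Unary.All as All using (All; []; _∷_)
  import Data.List.Relation.Unary.All.Properties as All
  open import Data.List.Relation.Unary.AllPairs as AllPairs using (AllPairs; []; _∷_)
  import Data.List.Relation.Unary.AllPairs.Properties as AllPairs
  open import Data.Product using (∃; Σ-syntax; ∃-syntax; _×_; _,_; proj₁; proj₂)
  open import Data.Sum using (_⊎_; inj₁; inj₂; [_,_]′)
  open import Function using (id; _∘_)
  open import Function.Definitions using (Injective)
  open import Relation.Nullary using (Dec; yes; no; does; proof; ¬_; contradiction)
  open import Relation.Nullary.Reflects using (Reflects; invert)
  open import Relation.Nullary.Decidable using (_×-dec_; dec-true)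
  open import Relation.Binary.PropositionalEquality
    using (_≡_; refl; sym; trans; cong; subst; subst₂; ≢-sym)

  ∣p∣≡∣p─q∣+∣p∩q∣ : ∀ {n} (p q : Subset n) → ∣ p ∣ ≡ ∣ p ─ q ∣ + ∣ p ∩ q ∣
  ∣p∣≡∣p─q∣+∣p∩q∣ []          []          = refl
  ∣p∣≡∣p─q∣+∣p∩q∣ (true  ∷ p) (true  ∷ q) = trans (cong suc (∣p∣≡∣p─q∣+∣p∩q∣ p q)) (sym (+-suc _ _))
  ∣p∣≡∣p─q∣+∣p∩q∣ (true  ∷ p) (false ∷ q) = cong suc (∣p∣≡∣p─q∣+∣p∩q∣ p q)
  ∣p∣≡∣p─q∣+∣p∩q∣ (false ∷ p) (true  ∷ q) = ∣p∣≡∣p─q∣+∣p∩q∣ p q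
  ∣p∣≡∣p─q∣+∣p∩q∣ (false ∷ p) (false ∷ q) = ∣p∣≡∣p─q∣+∣p∩q∣ p q

  x∈p─q⇒x∉q : ∀ {n} {x : Fin n} (p q : Subset n) → x ∈ p ─ q → x ∉ q
  x∈p─q⇒x∉q {x = zero}  (_ ∷ p) (true  ∷ q) ()
  x∈p─q⇒x∉q {x = zero}  (_ ∷ p) (false ∷ q) _          ()
  x∈p─q⇒x∉q {x = suc x} (_ ∷ p) (_     ∷ q) (there x∈) (there x∈q) = x∈p─q⇒x∉q p q x∈ x∈q

  x∈p-y⇒x≢y : ∀ {n} {x y : Fin n} (p : Subset n) → x ∈ p - y → x ≢ y
  x∈p-y⇒x≢y {y = y} p x∈ refl = x∈p─q⇒x∉q p ⁅ y ⁆ x∈ (x∈⁅x⁆ y)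

  ∣p∣≤∣p─q∣+∣q∣ : ∀ {n} (p q : Subset n) → ∣ p ∣ ≤ ∣ p ─ q ∣ + ∣ q ∣
  ∣p∣≤∣p─q∣+∣q∣ p q =
    ≤-trans (≤-reflexive (∣p∣≡∣p─q∣+∣p∩q∣ p q)) (+-monoʳ-≤ ∣ p ─ q ∣ (∣p∩q∣≤∣q∣ p q))

  ∣p∣≤∣p-x∣+1 : ∀ {n} (p : Subset n) x → ∣ p ∣ ≤ ∣ p - x ∣ + 1
  ∣p∣≤∣p-x∣+1 p x = subst (λ k → ∣ p ∣ ≤ ∣ p - x ∣ + k) (∣⁅x⁆∣≡1 x) (∣p∣≤∣p─q∣+∣q∣ p ⁅ x ⁆)

  ∣p∪q∣≤∣p∣+∣q∣ : ∀ {n} (p q : Subset n) → ∣ p ∪ q ∣ ≤ ∣ p ∣ + ∣ q ∣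
  ∣p∪q∣≤∣p∣+∣q∣ p q = ≤-trans (∣p∣≤∣p─q∣+∣q∣ (p ∪ q) q) (+-monoˡ-≤ ∣ q ∣ (p⊆q⇒∣p∣≤∣q∣ inP))
    where
    inP : p ∪ q ─ q ⊆ p
    inP x∈ = [ id , (λ x∈q → contradiction x∈q (x∈p─q⇒x∉q (p ∪ q) q x∈)) ]′
               (x∈p∪q⁻ p q (p─q⊆p (p ∪ q) q x∈))

  disjoint⇒∣p∣+∣q∣≤∣p∪q∣ : ∀ {n} {p q : Subset n} → (∀ {x} → x ∈ p → x ∉ q) →
                           ∣ p ∣ + ∣ q ∣ ≤ ∣ p ∪ q ∣
  disjoint⇒∣p∣+∣q∣≤∣p∪q∣ {p = p} {q} disjoint =
    ≤-trans (+-mono-≤ (p⊆q⇒∣p∣≤∣q∣ inDifference) (p⊆q⇒∣p∣≤∣q∣ inMeet))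
            (≤-reflexive (sym (∣p∣≡∣p─q∣+∣p∩q∣ (p ∪ q) q)))
    where
    inDifference : p ⊆ p ∪ q ─ q
    inDifference x∈p = x∈p∧x∉q⇒x∈p─q (x∈p∪q⁺ (inj₁ x∈p)) (disjoint x∈p)
    inMeet : q ⊆ (p ∪ q) ∩ q
    inMeet x∈q = x∈p∩q⁺ (x∈p∪q⁺ (inj₂ x∈q) , x∈q)

  module _ {n p} {P : Fin n → Set p} (P? : ∀ x → Dec (P x)) where

    subsetOf : Subset n
    subsetOf = tabulate (does ∘ P?)

    ∈-subsetOf⁺ : ∀ {x} → P x → x ∈ subsetOf
    ∈-subsetOf⁺ {x} px = lookup⇒[]= x subsetOf (trans (lookup∘tabulate _ x) (dec-true (P? x) px))

    ∈-subsetOf⁻ : ∀ {x} → x ∈ subsetOf → P x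
    ∈-subsetOf⁻ {x} x∈ =
      invert (subst (Reflects (P x)) (trans (sym (lookup∘tabulate _ x)) ([]=⇒lookup x∈)) (proof (P? x)))

  empty⇒∣p∣≡0 : ∀ {n} {p : Subset n} → ¬ Nonempty p → ∣ p ∣ ≡ 0
  empty⇒∣p∣≡0 {n} empty = trans (cong ∣_∣ (Empty-unique empty)) (∣⊥∣≡0 n)

  empty⇒∣p∣≤ : ∀ {n k} {p : Subset n} → ¬ Nonempty p → ∣ p ∣ ≤ k
  empty⇒∣p∣≤ {k = k} empty = subst (_≤ k) (sym (empty⇒∣p∣≡0 empty)) z≤n

  lookup-injective : ∀ {a b} {A : Set a} {B : Set b} (f : A → B) {xs : List A} →
                     AllPairs (λ u v → f u ≢ f v) xs → Injective _≡_ _≡_ (f ∘ lookup xs)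
  lookup-injective f (distinct ∷ _) {zero}  {zero}  _  = refl
  lookup-injective f (distinct ∷ _) {zero}  {suc j} eq =
    contradiction eq (All.lookup distinct (∈-lookup j))
  lookup-injective f (distinct ∷ _) {suc i} {zero}  eq =
    contradiction (sym eq) (All.lookup distinct (∈-lookup i))
  lookup-injective f (_ ∷ distinct) {suc i} {suc j} eq = cong suc (lookup-injective f distinct eq)

  <+suc⇒≤+ : ∀ {a} b c → a < b + suc c → a ≤ b + c
  <+suc⇒≤+ b c a< = ≤-pred (≤-trans a< (≤-reflexive (+-suc b c)))

  module König {m n : ℕ} (E : Fin m → Fin n → Set) (E? : ∀ a b → Dec (E a b)) where

    AdjacentTo : Subset n → Subset m → Fin n → Set
    AdjacentTo C X b = b ∈ C × ∃ λ a → a ∈ X × E a b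

    adjacentTo? : ∀ C X b → Dec (AdjacentTo C X b)
    adjacentTo? C X b = b ∈? C ×-dec any? λ a → a ∈? X ×-dec E? a b

    neighbours : Subset n → Subset m → Subset n
    neighbours C X = subsetOf (adjacentTo? C X)

    ∈-neighbours⁺ : ∀ {C X a b} → b ∈ C → a ∈ X → E a b → b ∈ neighbours C X
    ∈-neighbours⁺ {C} {X} b∈C a∈X e = ∈-subsetOf⁺ (adjacentTo? C X) (b∈C , _ , a∈X , e)

    ∈-neighbours⁻ : ∀ {C X b} → b ∈ neighbours C X → AdjacentTo C X b
    ∈-neighbours⁻ {C} {X} = ∈-subsetOf⁻ (adjacentTo? C X)

    Edge : Set
    Edge = Fin m × Fin n

    Within : Subset m → Subset n → Edge → Set
    Within R C (a , b) = a ∈ R × b ∈ C × E a b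

    Separated : Edge → Edge → Set
    Separated (a , b) (a′ , b′) = a ≢ a′ × b ≢ b′

    record Matching (R : Subset m) (C : Subset n) : Set where
      field
        edges    : List Edge
        within   : All (Within R C) edges
        disjoint : AllPairs Separated edges

      size : ℕ
      size = length edges

    open Matching

    weaken : ∀ {R R′ C C′} → R ⊆ R′ → C ⊆ C′ → Matching R C → Matching R′ C′
    weaken R⊆ C⊆ M = record
      { edges    = edges M
      ; within   = All.map (λ (a∈ , b∈ , e) → R⊆ a∈ , C⊆ b∈ , e) (within M)
      ; disjoint = disjoint M
      }

    merge : ∀ {R₁ R₂ C₁ C₂} → (∀ {a} → a ∈ R₁ → a ∉ R₂) → (∀ {b} → b ∈ C₁ → b ∉ C₂) →
            (M₁ : Matching R₁ C₁) (M₂ : Matching R₂ C₂) →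
            Σ[ M ∈ Matching (R₁ ∪ R₂) (C₁ ∪ C₂) ] size M ≡ size M₁ + size M₂
    merge R-disjoint C-disjoint M₁ M₂ = M , length-++ (edges M₁)
      where
      separated : ∀ {e₁ e₂} → Within _ _ e₁ → Within _ _ e₂ → Separated e₁ e₂
      separated (a₁∈ , b₁∈ , _) (a₂∈ , b₂∈ , _) =
        (λ { refl → R-disjoint a₁∈ a₂∈ }) , (λ { refl → C-disjoint b₁∈ b₂∈ })
      M : Matching _ _
      M = record
        { edges    = edges M₁ ++ edges M₂
        ; within   = All.++⁺
                       (All.map (λ (a∈ , b∈ , e) → x∈p∪q⁺ (inj₁ a∈) , x∈p∪q⁺ (inj₁ b∈) , e) (within M₁))
                       (All.map (λ (a∈ , b∈ , e) → x∈p∪q⁺ (inj₂ a∈) , x∈p∪q⁺ (inj₂ b∈) , e) (within M₂))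
        ; disjoint = AllPairs.++⁺ (disjoint M₁) (disjoint M₂)
                       (All.map (λ w₁ → All.map (separated w₁) (within M₂)) (within M₁))
        }

    extend : ∀ {R C a b} → a ∈ R → b ∈ C → E a b → Matching (R - a) (C - b) → Matching R C
    extend {R} {C} a∈R b∈C e M = record
      { edges    = (_ , _) ∷ edges M
      ; within   = (a∈R , b∈C , e) ∷ within (weaken (p─q⊆p R _) (p─q⊆p C _) M)
      ; disjoint = All.map (λ (a′∈ , b′∈ , _) → ≢-sym (x∈p-y⇒x≢y R a′∈) , ≢-sym (x∈p-y⇒x≢y C b′∈))
                           (within M)
                   ∷ disjoint M
      }

    record MatchesAllBut (d : ℕ) (R : Subset m) (C : Subset n) : Set where
      field
        matching : Matching R C
        bound    : ∣ R ∣ ≤ size matching + d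

    DeficiencyAtMost : ℕ → Subset m → Subset n → Set
    DeficiencyAtMost d R C = ∀ X → X ⊆ R → ∣ X ∣ ≤ ∣ neighbours C X ∣ + d

    Expanding : ℕ → Subset m → Subset n → Set
    Expanding d R C = ∀ X → X ⊆ R → Nonempty X → ∣ X ∣ < ∣ neighbours C X ∣ + d

    SmallerSolved : Subset m → Set
    SmallerSolved R = ∀ {d R′ C} → ∣ R′ ∣ < ∣ R ∣ → DeficiencyAtMost d R′ C → MatchesAllBut d R′ C

    unmatched : ∀ {d R C} → ∣ R ∣ ≤ d → MatchesAllBut d R C
    unmatched R≤d = record
      { matching = record { edges = [] ; within = [] ; disjoint = [] }
      ; bound    = R≤d
      }

    dropVertex : ∀ {d R C u} → MatchesAllBut d (R - u) C → MatchesAllBut (suc d) R C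
    dropVertex {d} {R} {C} {u} sol = record { matching = weaken (p─q⊆p R _) id M ; bound = bound′ }
      where
      open MatchesAllBut sol renaming (matching to M)
      open ≤-Reasoning
      bound′ : ∣ R ∣ ≤ size M + suc d
      bound′ = begin
        ∣ R ∣              ≤⟨ ∣p∣≤∣p-x∣+1 R u ⟩
        ∣ R - u ∣ + 1      ≤⟨ +-monoˡ-≤ 1 bound ⟩
        size M + d + 1     ≡⟨ +-comm (size M + d) 1 ⟩
        suc (size M + d)   ≡⟨ +-suc (size M) d ⟨
        size M + suc d     ∎

    matchEdge : ∀ {d R C a b} → a ∈ R → b ∈ C → E a b →
                MatchesAllBut d (R - a) (C - b) → MatchesAllBut d R C
    matchEdge {d} {R} {C} {a} a∈R b∈C e sol = record { matching = extend a∈R b∈C e M ; bound = bound′ }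
      where
      open MatchesAllBut sol renaming (matching to M)
      open ≤-Reasoning
      bound′ : ∣ R ∣ ≤ suc (size M) + d
      bound′ = begin
        ∣ R ∣            ≤⟨ ∣p∣≤∣p-x∣+1 R a ⟩
        ∣ R - a ∣ + 1    ≤⟨ +-monoˡ-≤ 1 bound ⟩
        size M + d + 1   ≡⟨ +-comm (size M + d) 1 ⟩
        suc (size M) + d ∎

    expanding⇒deficiency : ∀ {d R C} → Expanding (suc d) R C → DeficiencyAtMost d R C
    expanding⇒deficiency {d} {C = C} expanding X X⊆R with nonempty? X
    ... | yes nonempty = <+suc⇒≤+ ∣ neighbours C X ∣ d (expanding X X⊆R nonempty)
    ... | no  empty    = empty⇒∣p∣≤ empty

    neighbours-─ : ∀ {C X} b → neighbours C X - b ⊆ neighbours (C - b) X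
    neighbours-─ {C} {X} b b′∈ with ∈-neighbours⁻ (p─q⊆p (neighbours C X) _ b′∈)
    ... | b′∈C , a , a∈X , e =
      ∈-neighbours⁺ (x∈p∧x≢y⇒x∈p-y b′∈C (x∈p-y⇒x≢y (neighbours C X) b′∈)) a∈X e

    expanding⇒deficiency-─ : ∀ {R C} b → Expanding 0 R C → DeficiencyAtMost 0 R (C - b)
    expanding⇒deficiency-─ {C = C} b expanding X X⊆R with nonempty? X
    ... | no  empty    = empty⇒∣p∣≤ empty
    ... | yes nonempty =
      subst (∣ X ∣ ≤_) (sym (+-identityʳ _)) (+-cancelʳ-≤ 1 _ _ (begin
        ∣ X ∣ + 1                          ≡⟨ +-comm ∣ X ∣ 1 ⟩
        suc ∣ X ∣                          ≤⟨ expanding X X⊆R nonempty ⟩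
        ∣ neighbours C X ∣ + 0             ≡⟨ +-identityʳ _ ⟩
        ∣ neighbours C X ∣                 ≤⟨ ∣p∣≤∣p-x∣+1 (neighbours C X) b ⟩
        ∣ neighbours C X - b ∣ + 1         ≤⟨ +-monoˡ-≤ 1 (p⊆q⇒∣p∣≤∣q∣ (neighbours-─ {C} {X} b)) ⟩
        ∣ neighbours (C - b) X ∣ + 1       ∎))
      where open ≤-Reasoning

    neighbourOf : ∀ {R C u} → DeficiencyAtMost 0 R C → u ∈ R → ∃ λ b → b ∈ C × E u b
    neighbourOf {R} {C} {u} hall u∈R with nonempty? (neighbours C ⁅ u ⁆)
    ... | yes (b , b∈) with b∈C , a , a∈⁅u⁆ , e ← ∈-neighbours⁻ b∈ =
      b , b∈C , subst (λ a → E a b) (x∈⁅y⁆⇒x≡y u a∈⁅u⁆) e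
    ... | no empty = contradiction one≤zero λ ()
      where
      one≤zero : 1 ≤ 0 + 0
      one≤zero = subst₂ _≤_ (∣⁅x⁆∣≡1 u) (cong (_+ 0) (empty⇒∣p∣≡0 empty))
                   (hall ⁅ u ⁆ λ x∈⁅u⁆ → subst (_∈ R) (sym (x∈⁅y⁆⇒x≡y u x∈⁅u⁆)) u∈R)

    criticalInside : ∀ {d R C X} → DeficiencyAtMost d R C → X ⊆ R →
                     DeficiencyAtMost d X (neighbours C X)
    criticalInside {d} {C = C} {X} hall X⊆R Y Y⊆X =
      ≤-trans (hall Y (X⊆R ∘ Y⊆X)) (+-monoˡ-≤ d (p⊆q⇒∣p∣≤∣q∣ throughX))
      where
      throughX : neighbours C Y ⊆ neighbours (neighbours C X) Y
      throughX b∈ with b∈C , a , a∈Y , e ← ∈-neighbours⁻ b∈ =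
        ∈-neighbours⁺ (∈-neighbours⁺ b∈C (Y⊆X a∈Y) e) a∈Y e

    criticalOutside : ∀ {d R C X} → DeficiencyAtMost d R C → X ⊆ R →
                      ∣ neighbours C X ∣ + d ≤ ∣ X ∣ →
                      DeficiencyAtMost 0 (R ─ X) (C ─ neighbours C X)
    criticalOutside {d} {R} {C} {X} hall X⊆R critical Y Y⊆R─X =
      subst (∣ Y ∣ ≤_) (sym (+-identityʳ _)) (+-cancelʳ-≤ ∣ X ∣ _ _ (begin
        ∣ Y ∣ + ∣ X ∣                     ≤⟨ disjoint⇒∣p∣+∣q∣≤∣p∪q∣ (x∈p─q⇒x∉q R X ∘ Y⊆R─X) ⟩
        ∣ Y ∪ X ∣                         ≤⟨ hall (Y ∪ X) Y∪X⊆R ⟩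
        ∣ neighbours C (Y ∪ X) ∣ + d      ≤⟨ +-monoˡ-≤ d (≤-trans (p⊆q⇒∣p∣≤∣q∣ split) (∣p∪q∣≤∣p∣+∣q∣ N′ N)) ⟩
        ∣ N′ ∣ + ∣ N ∣ + d                ≡⟨ +-assoc ∣ N′ ∣ ∣ N ∣ d ⟩
        ∣ N′ ∣ + (∣ N ∣ + d)              ≤⟨ +-monoʳ-≤ ∣ N′ ∣ critical ⟩
        ∣ N′ ∣ + ∣ X ∣                    ∎))
      where
      open ≤-Reasoning
      N N′ : Subset n
      N  = neighbours C X
      N′ = neighbours (C ─ N) Y
      Y∪X⊆R : Y ∪ X ⊆ R
      Y∪X⊆R a∈ = [ p─q⊆p R X ∘ Y⊆R─X , X⊆R ]′ (x∈p∪q⁻ Y X a∈)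
      split : neighbours C (Y ∪ X) ⊆ N′ ∪ N
      split {b} b∈ with ∈-neighbours⁻ b∈ | b ∈? N
      ... | _                     | yes b∈N = x∈p∪q⁺ (inj₂ b∈N)
      ... | b∈C , a , a∈Y∪X , e | no  b∉N = x∈p∪q⁺ (inj₁ (∈-neighbours⁺ (x∈p∧x∉q⇒x∈p─q b∈C b∉N) a∈Y e))
        where
        a∈Y : a ∈ Y
        a∈Y = [ id , (λ a∈X → contradiction (∈-neighbours⁺ b∈C a∈X e) b∉N) ]′ (x∈p∪q⁻ Y X a∈Y∪X)

    splitAtCritical : ∀ {d R C X} → SmallerSolved R → DeficiencyAtMost d R C →
                      X ⊆ R → Nonempty X → ∣ X ∣ < ∣ R ∣ → ∣ neighbours C X ∣ + d ≤ ∣ X ∣ →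
                      MatchesAllBut d R C
    splitAtCritical {d} {R} {C} {X} solve hall X⊆R (x , x∈X) X<R critical =
      record { matching = weaken R-covered C-covered M ; bound = bound′ }
      where
      N : Subset n
      N = neighbours C X
      inside  = solve X<R (criticalInside hall X⊆R)
      outside = solve (p∩q≢∅⇒∣p─q∣<∣p∣ R X (x , x∈p∩q⁺ (X⊆R x∈X , x∈X)))
                      (criticalOutside hall X⊆R critical)
      open MatchesAllBut inside  renaming (matching to M₁; bound to bound₁)
      open MatchesAllBut outside renaming (matching to M₂; bound to bound₂)
      merged = merge (λ a∈X a∈R─X → x∈p─q⇒x∉q R X a∈R─X a∈X)
                     (λ b∈N b∈C─N → x∈p─q⇒x∉q C N b∈C─N b∈N) M₁ M₂
      M = proj₁ merged
      R-covered : X ∪ (R ─ X) ⊆ R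
      R-covered a∈ = [ X⊆R , p─q⊆p R X ]′ (x∈p∪q⁻ X (R ─ X) a∈)
      C-covered : N ∪ (C ─ N) ⊆ C
      C-covered b∈ = [ proj₁ ∘ ∈-neighbours⁻ , p─q⊆p C N ]′ (x∈p∪q⁻ N (C ─ N) b∈)
      open ≤-Reasoning
      bound′ : ∣ R ∣ ≤ size M + d
      bound′ = begin
        ∣ R ∣                               ≤⟨ ∣p∣≤∣p─q∣+∣q∣ R X ⟩
        ∣ R ─ X ∣ + ∣ X ∣                   ≤⟨ +-mono-≤ bound₂ bound₁ ⟩
        size M₂ + 0 + (size M₁ + d)         ≡⟨ cong (_+ (size M₁ + d)) (+-identityʳ (size M₂)) ⟩
        size M₂ + (size M₁ + d)             ≡⟨ +-assoc (size M₂) (size M₁) d ⟨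
        size M₂ + size M₁ + d               ≡⟨ cong (_+ d) (+-comm (size M₂) (size M₁)) ⟩
        size M₁ + size M₂ + d               ≡⟨ cong (_+ d) (proj₂ merged) ⟨
        size M + d                          ∎

    growExpanding : ∀ {d R C u} → u ∈ R → SmallerSolved R → DeficiencyAtMost d R C →
                    Expanding d (R - u) C → MatchesAllBut d R C
    growExpanding {suc d} u∈R solve _ expanding =
      dropVertex (solve (x∈p⇒∣p-x∣<∣p∣ u∈R) (expanding⇒deficiency expanding))
    growExpanding {zero} u∈R solve hall expanding with b , b∈C , e ← neighbourOf hall u∈R =
      matchEdge u∈R b∈C e (solve (x∈p⇒∣p-x∣<∣p∣ u∈R) (expanding⇒deficiency-─ b expanding))

    growAt : ∀ {d R C u} → u ∈ R → SmallerSolved R → DeficiencyAtMost d R C → MatchesAllBut d R C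
    growAt {d} {R} {C} {u} u∈R solve hall
      with anySubset? (λ X → X ⊆? R - u ×-dec nonempty? X ×-dec ∣ neighbours C X ∣ + d ≤? ∣ X ∣)
    ... | yes (X , X⊆R-u , nonempty , critical) =
      splitAtCritical solve hall (p─q⊆p R _ ∘ X⊆R-u) nonempty
        (≤-<-trans (p⊆q⇒∣p∣≤∣q∣ X⊆R-u) (x∈p⇒∣p-x∣<∣p∣ u∈R)) critical
    ... | no noCritical =
      growExpanding u∈R solve hall λ X X⊆ nonempty →
        ≰⇒> λ critical → noCritical (X , X⊆ , nonempty , critical)

    defectHall-bounded : ∀ f {d R C} → ∣ R ∣ ≤ f → DeficiencyAtMost d R C → MatchesAllBut d R C
    defectHall-bounded zero    R≤0 _ = unmatched (≤-trans R≤0 z≤n)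
    defectHall-bounded (suc f) {R = R} R≤ hall with nonempty? R
    ... | no  empty       = unmatched (empty⇒∣p∣≤ empty)
    ... | yes (u , u∈R) = growAt u∈R (λ R′<R → defectHall-bounded f (≤-pred (<-≤-trans R′<R R≤))) hall

    defectHall : ∀ {d R C} → DeficiencyAtMost d R C → MatchesAllBut d R C
    defectHall {R = R} = defectHall-bounded ∣ R ∣ ≤-refl

    maximumDeficiency : ∀ d → DeficiencyAtMost d ⊤ ⊤ →
                        ∃[ d′ ] DeficiencyAtMost d′ ⊤ ⊤ × ∃[ X ] ∣ neighbours ⊤ X ∣ + d′ ≤ ∣ X ∣
    maximumDeficiency zero hall =
      zero , hall , ⊥ , ≤-trans (≤-reflexive (+-identityʳ _))
                          (empty⇒∣p∣≤ λ (_ , b∈) → ∉⊥ (proj₁ (proj₂ (proj₂ (∈-neighbours⁻ b∈)))))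
    maximumDeficiency (suc d) hall with anySubset? (λ X → ∣ neighbours ⊤ X ∣ + suc d ≤? ∣ X ∣)
    ... | yes (X , critical) = suc d , hall , X , critical
    ... | no noCritical =
      maximumDeficiency d λ X _ → <+suc⇒≤+ _ d (≰⇒> λ critical → noCritical (X , critical))

    Cover : Subset m → Subset n → Set
    Cover S₁ S₂ = ∀ a b → E a b → a ∈ S₁ ⊎ b ∈ S₂

    König : Σ[ M ∈ Matching ⊤ ⊤ ] Σ[ S₁ ∈ Subset m ] Σ[ S₂ ∈ Subset n ]
              Cover S₁ S₂ × ∣ S₁ ∣ + ∣ S₂ ∣ ≤ size M
    König with d , hall , X , critical ← maximumDeficiency m (λ X _ → ≤-trans (∣p∣≤n X) (m≤n+m m _)) =
      matching , ∁ X , neighbours ⊤ X , cover , small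
      where
      open MatchesAllBut (defectHall hall)
      cover : Cover (∁ X) (neighbours ⊤ X)
      cover a b e with a ∈? X
      ... | yes a∈X = inj₂ (∈-neighbours⁺ ∈⊤ a∈X e)
      ... | no  a∉X = inj₁ (x∉p⇒x∈∁p a∉X)
      open ≤-Reasoning
      small : ∣ ∁ X ∣ + ∣ neighbours ⊤ X ∣ ≤ size matching
      small = +-cancelʳ-≤ d _ _ (begin
        ∣ ∁ X ∣ + ∣ neighbours ⊤ X ∣ + d    ≡⟨ +-assoc ∣ ∁ X ∣ _ d ⟩
        ∣ ∁ X ∣ + (∣ neighbours ⊤ X ∣ + d)  ≤⟨ +-monoʳ-≤ ∣ ∁ X ∣ critical ⟩
        ∣ ∁ X ∣ + ∣ X ∣                     ≡⟨ cong (_+ ∣ X ∣) (∣∁p∣≡n∸∣p∣ X) ⟩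
        m ∸ ∣ X ∣ + ∣ X ∣                   ≡⟨ m∸n+n≡m (∣p∣≤n X) ⟩
        m                                   ≡⟨ ∣⊤∣≡n m ⟨
        ∣ ⊤ {m} ∣                           ≤⟨ bound ⟩
        size matching + d                   ∎)

open BipartiteMatching using (module König; lookup-injective)

module _ {c ℓ} (F : Field c ℓ) where

  open import Level using (_⊔_)
  import Data.Nat as ℕ
  open import Data.Nat using (zero; suc)
  import Data.Nat.Properties as ℕ
  open import Data.Integer as ℤ using (ℤ; +_; -[1+_])
  import Data.Integer.Properties as ℤ
  open import Data.Fin using (zero; suc; toℕ; combine)
  import Data.Fin as Fin
  import Data.Fin.Properties as Fin
  open import Data.Fin.Subset using (⊤)
  open import Data.List using ([]; _∷_; length; lookup)
  open import Data.List.Membership.Propositional.Properties using (∈-lookup)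
  import Data.List.Relation.Unary.All as All
  import Data.List.Relation.Unary.AllPairs as AllPairs
  open import Data.Product using (Σ-syntax; _×_; _,_; proj₁; proj₂)
  import Data.Product as Product
  import Data.Product.Properties as Product
  open import Data.Sum using (_⊎_; inj₁; inj₂)
  import Data.Sum as Sum
  open import Function using (id; _∘_)
  open import Function.Definitions using (Injective)
  open import Relation.Nullary using (Dec; yes; no; ¬_; contradiction)
  open import Relation.Nullary.Decidable using (_×-dec_)
  open import Relation.Binary using (tri<; tri≈; tri>)
  open import Relation.Binary.PropositionalEquality
    using (_≡_; refl; sym; trans; cong; cong₂; subst; subst₂)

  open FieldDefs F
  open Field F
    using (Carrier; _≈_; _+_; _*_; 0#; 1#; inverse; setoid; semiring; *-commutativeSemigroup;
           +-cong; +-congˡ; +-congʳ; *-congˡ; *-assoc; *-comm; *-identityˡ;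
           +-identityˡ; +-identityʳ; zeroˡ; zeroʳ)
    renaming (refl to ≈-refl; sym to ≈-sym; trans to ≈-trans; reflexive to ≈-reflexive)
  open import Algebra.Properties.Semiring.Sum semiring
    using (sum; sum-cong-≋; sum-replicate-zero; ∑-comm; *-distribˡ-sum)
  open import Algebra.Properties.CommutativeSemigroup *-commutativeSemigroup using (x∙yz≈y∙xz)
  open import Algebra.Properties.CommutativeSemigroup ℕ.+-commutativeSemigroup using (xy∙z≈xz∙y)
  open import Relation.Binary.Reasoning.Setoid setoid

  pcoeff-padd : ∀ p q k → pcoeff (padd p q) k ≈ pcoeff p k + pcoeff q k
  pcoeff-padd []      q       k       = ≈-sym (+-identityˡ _)
  pcoeff-padd (x ∷ p) []      k       = ≈-sym (+-identityʳ _)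
  pcoeff-padd (x ∷ p) (y ∷ q) zero    = ≈-refl
  pcoeff-padd (x ∷ p) (y ∷ q) (suc k) = pcoeff-padd p q k

  pcoeff-pscale : ∀ x q k → pcoeff (pscale x q) k ≈ x * pcoeff q k
  pcoeff-pscale x []      k       = ≈-sym (zeroʳ x)
  pcoeff-pscale x (y ∷ q) zero    = ≈-refl
  pcoeff-pscale x (y ∷ q) (suc k) = pcoeff-pscale x q k

  pcoeff-pmul-[x] : ∀ x q k → pcoeff (pmul (x ∷ []) q) k ≈ x * pcoeff q k
  pcoeff-pmul-[x] x q k = begin
    pcoeff (padd (pscale x q) (0# ∷ [])) k      ≈⟨ pcoeff-padd (pscale x q) _ k ⟩
    pcoeff (pscale x q) k + pcoeff (0# ∷ []) k  ≈⟨ +-cong (pcoeff-pscale x q k) (pcoeff-[0#] k) ⟩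
    x * pcoeff q k + 0#                         ≈⟨ +-identityʳ _ ⟩
    x * pcoeff q k                              ∎
    where
    pcoeff-[0#] : ∀ k → pcoeff (0# ∷ []) k ≈ 0#
    pcoeff-[0#] zero    = ≈-refl
    pcoeff-[0#] (suc _) = ≈-refl

  pcoeff-pmul-0∷ : ∀ p q k → pcoeff (pmul (0# ∷ p) q) k ≈ pcoeff (0# ∷ pmul p q) k
  pcoeff-pmul-0∷ p q k = begin
    pcoeff (padd (pscale 0# q) (0# ∷ pmul p q)) k
      ≈⟨ pcoeff-padd (pscale 0# q) _ k ⟩
    pcoeff (pscale 0# q) k + pcoeff (0# ∷ pmul p q) k
      ≈⟨ +-congʳ (≈-trans (pcoeff-pscale 0# q k) (zeroˡ _)) ⟩
    0# + pcoeff (0# ∷ pmul p q) k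
      ≈⟨ +-identityˡ _ ⟩
    pcoeff (0# ∷ pmul p q) k
      ∎

  IsMonomial : Poly → ℕ → Carrier → Set ℓ
  IsMonomial p N v = ∀ k → (k ≡ N → pcoeff p k ≈ v) × (¬ k ≡ N → pcoeff p k ≈ 0#)

  IsMonomial-[t] : ∀ t → IsMonomial (t ∷ []) 0 t
  IsMonomial-[t] t zero    = (λ _ → ≈-refl) , (λ 0≢0 → contradiction refl 0≢0)
  IsMonomial-[t] t (suc k) = (λ ()) , (λ _ → ≈-refl)

  IsMonomial-pmul : ∀ {q N v} p x → IsMonomial q N v →
                    IsMonomial (pmul (pshift p (x ∷ [])) q) (p ℕ.+ N) (x * v)
  IsMonomial-pmul {q} zero x mono k =
    (λ k≡N → ≈-trans (pcoeff-pmul-[x] x q k) (*-congˡ (proj₁ (mono k) k≡N))) ,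
    (λ k≢N → ≈-trans (pcoeff-pmul-[x] x q k) (≈-trans (*-congˡ (proj₂ (mono k) k≢N)) (zeroʳ x)))
  IsMonomial-pmul {q} (suc p) x mono zero = (λ ()) , (λ _ → pcoeff-pmul-0∷ (pshift p (x ∷ [])) q zero)
  IsMonomial-pmul {q} (suc p) x mono (suc k) =
    (λ eq → ≈-trans shift (proj₁ (IsMonomial-pmul p x mono k) (ℕ.suc-injective eq))) ,
    (λ neq → ≈-trans shift (proj₂ (IsMonomial-pmul p x mono k) (neq ∘ cong suc)))
    where
    shift = pcoeff-pmul-0∷ (pshift p (x ∷ [])) q (suc k)

  pcoeffℤ : Poly → ℤ → Carrier
  pcoeffℤ p (+ k)     = pcoeff p k
  pcoeffℤ p -[1+ _ ]  = 0#

  lcoeff-laurent : ∀ k p e → lcoeff (laurent k p) e ≡ pcoeffℤ p (e ℤ.+ + k)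
  lcoeff-laurent k p e with e ℤ.+ + k
  ... | + _      = refl
  ... | -[1+ _ ] = refl

  pcoeffℤ-[] : ∀ w → pcoeffℤ [] w ≡ 0#
  pcoeffℤ-[] (+ _)     = refl
  pcoeffℤ-[] -[1+ _ ]  = refl

  pcoeffℤ-padd : ∀ p q w → pcoeffℤ (padd p q) w ≈ pcoeffℤ p w + pcoeffℤ q w
  pcoeffℤ-padd p q (+ k)     = pcoeff-padd p q k
  pcoeffℤ-padd p q -[1+ _ ]  = ≈-sym (+-identityʳ 0#)

  pcoeffℤ-0∷ : ∀ p w → pcoeffℤ (0# ∷ p) (ℤ.suc w) ≡ pcoeffℤ p w
  pcoeffℤ-0∷ p (+ k)          = refl
  pcoeffℤ-0∷ p -[1+ zero ]    = refl
  pcoeffℤ-0∷ p -[1+ suc k ]   = refl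

  i+[1+n]≡suc[i+n] : ∀ i n → i ℤ.+ + suc n ≡ ℤ.suc (i ℤ.+ + n)
  i+[1+n]≡suc[i+n] i n =
    trans (ℤ.+-comm i (+ suc n)) (trans (ℤ.suc-+ n i) (cong ℤ.suc (ℤ.+-comm (+ n) i)))

  pcoeffℤ-pshift : ∀ l p w → pcoeffℤ (pshift l p) (w ℤ.+ + l) ≡ pcoeffℤ p w
  pcoeffℤ-pshift zero    p w = cong (pcoeffℤ p) (ℤ.+-identityʳ w)
  pcoeffℤ-pshift (suc l) p w =
    trans (cong (pcoeffℤ (pshift (suc l) p)) (i+[1+n]≡suc[i+n] w l))
          (trans (pcoeffℤ-0∷ (pshift l p) (w ℤ.+ + l)) (pcoeffℤ-pshift l p w))

  lcoeff-ladd : ∀ u v e → lcoeff (ladd u v) e ≈ lcoeff u e + lcoeff v e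
  lcoeff-ladd (laurent k p) (laurent l q) e = begin
    lcoeff (ladd (laurent k p) (laurent l q)) e
      ≡⟨ lcoeff-laurent (k ℕ.+ l) _ e ⟩
    pcoeffℤ (padd (pshift l p) (pshift k q)) (e ℤ.+ + (k ℕ.+ l))
      ≈⟨ pcoeffℤ-padd (pshift l p) (pshift k q) (e ℤ.+ + (k ℕ.+ l)) ⟩
    pcoeffℤ (pshift l p) (e ℤ.+ + (k ℕ.+ l)) + pcoeffℤ (pshift k q) (e ℤ.+ + (k ℕ.+ l))
      ≡⟨ cong₂ _+_ (trans (cong (pcoeffℤ (pshift l p)) (sym (ℤ.+-assoc e (+ k) (+ l))))
                          (pcoeffℤ-pshift l p (e ℤ.+ + k)))
                   (trans (cong (pcoeffℤ (pshift k q)) e+[k+l]≡[e+l]+k)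
                          (pcoeffℤ-pshift k q (e ℤ.+ + l))) ⟩
    pcoeffℤ p (e ℤ.+ + k) + pcoeffℤ q (e ℤ.+ + l)
      ≡⟨ cong₂ _+_ (lcoeff-laurent k p e) (lcoeff-laurent l q e) ⟨
    lcoeff (laurent k p) e + lcoeff (laurent l q) e
      ∎
    where
    e+[k+l]≡[e+l]+k : e ℤ.+ + (k ℕ.+ l) ≡ e ℤ.+ + l ℤ.+ + k
    e+[k+l]≡[e+l]+k = trans (cong (λ n → e ℤ.+ + n) (ℕ.+-comm k l)) (sym (ℤ.+-assoc e (+ l) (+ k)))

  lcoeff-lsum : ∀ {n} (f : Fin n → Laurent) e → lcoeff (lsum f) e ≈ sum λ i → lcoeff (f i) e
  lcoeff-lsum {zero}  f e = ≈-reflexive (trans (lcoeff-laurent 0 [] e) (pcoeffℤ-[] (e ℤ.+ + 0)))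
  lcoeff-lsum {suc n} f e =
    ≈-trans (lcoeff-ladd (f zero) _ e) (+-cong ≈-refl (lcoeff-lsum (f ∘ suc) e))

  -- u = ε^(N − K) · V
  IsLaurentMonomial : Laurent → ℕ → ℕ → Carrier → Set ℓ
  IsLaurentMonomial u K N V =
    ∀ e → (e ℤ.+ + K ≡ + N → lcoeff u e ≈ V) × (¬ e ℤ.+ + K ≡ + N → lcoeff u e ≈ 0#)

  laurent-monomial : ∀ {P N V} K → IsMonomial P N V → IsLaurentMonomial (laurent K P) K N V
  laurent-monomial {P} {N} {V} K mono e rewrite lcoeff-laurent K P e = atExponent (e ℤ.+ + K)
    where
    atExponent : ∀ w → (w ≡ + N → pcoeffℤ P w ≈ V) × (¬ w ≡ + N → pcoeffℤ P w ≈ 0#)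
    atExponent (+ k)    = proj₁ (mono k) ∘ ℤ.+-injective , λ k≢N → proj₂ (mono k) (k≢N ∘ cong (+_))
    atExponent -[1+ _ ] = (λ ()) , (λ _ → ≈-refl)

  lsum-monomial : ∀ {n K N} {f : Fin n → Laurent} {V : Fin n → Carrier} →
                  (∀ i → IsLaurentMonomial (f i) K N (V i)) → IsLaurentMonomial (lsum f) K N (sum V)
  lsum-monomial {n} {f = f} mono e =
    (λ eq → ≈-trans (lcoeff-lsum f e) (sum-cong-≋ λ i → proj₁ (mono i e) eq)) ,
    (λ neq → ≈-trans (lcoeff-lsum f e)
               (≈-trans (sum-cong-≋ λ i → proj₂ (mono i e) neq) (sum-replicate-zero n)))

  negativeExponent : ∀ {m K N} → -[1+ m ] ℤ.+ + K ≡ + N → N ℕ.< K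
  negativeExponent {m} {K} eq = ℤ.drop‿+<+ (subst (ℤ._< + K) eq (ℤ.+-monoˡ-< (+ K) (ℤ.-<+ {m} {0})))

  module _ {u K N V} (mono : IsLaurentMonomial u K N V) where

    vanishing : V ≈ 0# → ∀ e → lcoeff u e ≈ 0#
    vanishing V≈0 e with e ℤ.+ + K ℤ.≟ + N
    ... | yes eq  = ≈-trans (proj₁ (mono e) eq) V≈0
    ... | no  neq = proj₂ (mono e) neq

    constantTerm : K ≡ N → lcoeff u (+ 0) ≈ V
    constantTerm K≡N = proj₁ (mono (+ 0)) (cong (+_) K≡N)

    constantTerm-vanishes : K ℕ.< N ⊎ V ≈ 0# → lcoeff u (+ 0) ≈ 0#
    constantTerm-vanishes (inj₁ K<N) = proj₂ (mono (+ 0)) λ eq → ℕ.<-irrefl (ℤ.+-injective eq) K<N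
    constantTerm-vanishes (inj₂ V≈0) = vanishing V≈0 (+ 0)

    noPole : K ≤ N ⊎ V ≈ 0# → ∀ m → lcoeff u -[1+ m ] ≈ 0#
    noPole (inj₁ K≤N) m = proj₂ (mono -[1+ m ]) λ eq → ℕ.<⇒≱ (negativeExponent eq) K≤N
    noPole (inj₂ V≈0) m = vanishing V≈0 -[1+ m ]

  record MonomialMatrix (r n : ℕ) : Set c where
    field
      negExp posExp : Fin r → ℕ
      vector        : Fin r → Fin n → Carrier

    toLMatrix : LMatrix r n
    toLMatrix x a = laurent (negExp x) (pshift (posExp x) (vector x a ∷ []))

  open MonomialMatrix

  Diagonal : ∀ {r} → Fin r → Fin r → Fin r → Set
  Diagonal x y z = x ≡ y × y ≡ z

  -- ε^(N − K) · V has no pole, and its value at ε = 0 is 1 or 0 according as D holds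
  UnitEntry : Set → ℕ → ℕ → Carrier → Set ℓ
  UnitEntry D K N V = (D → K ≡ N × V ≈ 1#) × (¬ D → K ℕ.< N ⊎ V ≈ 0#)

  UnitEntry-transport : ∀ {D D′ K K′ N N′ V V′} → (D′ → D) → (D → D′) →
                        K ≡ K′ → N ≡ N′ → V ≈ V′ → UnitEntry D K N V → UnitEntry D′ K′ N′ V′
  UnitEntry-transport D′⇒D D⇒D′ refl refl V≈V′ (onDiagonal , offDiagonal) =
    Product.map₂ (≈-trans (≈-sym V≈V′)) ∘ onDiagonal ∘ D′⇒D ,
    Sum.map₂ (≈-trans (≈-sym V≈V′)) ∘ offDiagonal ∘ (_∘ D⇒D′)

  record MonomialRestriction {n₁ n₂ n₃} (T : Tensor n₁ n₂ n₃) (s : ℕ) : Set (c ⊔ ℓ) where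
    field
      A : MonomialMatrix s n₁
      B : MonomialMatrix s n₂
      C : MonomialMatrix s n₃

    negExpAt : Fin s → Fin s → Fin s → ℕ
    negExpAt x y z = negExp A x ℕ.+ negExp B y ℕ.+ negExp C z

    posExpAt : Fin s → Fin s → Fin s → ℕ
    posExpAt x y z = posExp A x ℕ.+ posExp B y ℕ.+ posExp C z

    valueAt : Fin s → Fin s → Fin s → Carrier
    valueAt x y z =
      sum λ a → sum λ b → sum λ c → vector A x a * (vector B y b * (vector C z c * T a b c))

    field
      unitEntries : ∀ x y z →
                    UnitEntry (Diagonal x y z) (negExpAt x y z) (posExpAt x y z) (valueAt x y z)

    image : Fin s → Fin s → Fin s → Laurent
    image = applyABC (toLMatrix A) (toLMatrix B) (toLMatrix C) T

    image-monomial : ∀ x y z → IsLaurentMonomial (image x y z) (negExpAt x y z) (posExpAt x y z) (valueAt x y z)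
    image-monomial x y z =
      subst₂ (λ K N → IsLaurentMonomial (image x y z) K N (valueAt x y z))
        (a+[b+[c+0]]≡a+b+c (negExp A x) (negExp B y) (negExp C z))
        (a+[b+[c+0]]≡a+b+c (posExp A x) (posExp B y) (posExp C z))
        (lsum-monomial λ a → lsum-monomial λ b → lsum-monomial λ c →
          laurent-monomial _
            (IsMonomial-pmul (posExp A x) (vector A x a)
              (IsMonomial-pmul (posExp B y) (vector B y b)
                (IsMonomial-pmul (posExp C z) (vector C z c) (IsMonomial-[t] (T a b c))))))
      where
      a+[b+[c+0]]≡a+b+c : ∀ a b c → a ℕ.+ (b ℕ.+ (c ℕ.+ 0)) ≡ a ℕ.+ b ℕ.+ c
      a+[b+[c+0]]≡a+b+c a b c =
        trans (cong (λ k → a ℕ.+ (b ℕ.+ k)) (ℕ.+-identityʳ c)) (sym (ℕ.+-assoc a b c))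

  unitTensor-diagonal : ∀ {r} {x y z : Fin r} → Diagonal x y z → unitTensor r x y z ≈ 1#
  unitTensor-diagonal {x = x} (refl , refl) with x Fin.≟ x
  ... | yes _   = ≈-refl
  ... | no  x≢x = contradiction refl x≢x

  unitTensor-offDiagonal : ∀ {r} {x y z : Fin r} → ¬ Diagonal x y z → unitTensor r x y z ≈ 0#
  unitTensor-offDiagonal {x = x} {y} {z} offDiagonal with x Fin.≟ y | y Fin.≟ z
  ... | yes x≡y | yes y≡z = contradiction (x≡y , y≡z) offDiagonal
  ... | yes _   | no  _   = ≈-refl
  ... | no  _   | yes _   = ≈-refl
  ... | no  _   | no  _   = ≈-refl

  monomialRestriction⇒borderRestricts : ∀ {n₁ n₂ n₃} {T : Tensor n₁ n₂ n₃} {s} →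
                                        MonomialRestriction T s → BorderRestricts T s
  monomialRestriction⇒borderRestricts {T = T} {s} R =
    toLMatrix A , toLMatrix B , toLMatrix C ,
    (λ x y z → proj₁ (entry x y z)) , (λ x y z → proj₂ (entry x y z))
    where
    open MonomialRestriction R
    entry : ∀ x y z → lcoeff (image x y z) (+ 0) ≈ unitTensor s x y z × (∀ m → lcoeff (image x y z) -[1+ m ] ≈ 0#)
    entry x y z with x Fin.≟ y ×-dec y Fin.≟ z | unitEntries x y z
    ... | yes diagonal | onDiagonal , _ =
      ≈-trans (constantTerm mono K≡N) (≈-trans V≈1 (≈-sym (unitTensor-diagonal diagonal))) ,
      noPole mono (inj₁ (ℕ.≤-reflexive K≡N))
      where
      mono = image-monomial x y z
      K≡N = proj₁ (onDiagonal diagonal)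
      V≈1 = proj₂ (onDiagonal diagonal)
    ... | no offDiagonal | _ , offDiagonal⇒ =
      ≈-trans (constantTerm-vanishes mono (offDiagonal⇒ offDiagonal))
              (≈-sym (unitTensor-offDiagonal offDiagonal)) ,
      noPole mono (Sum.map₁ ℕ.<⇒≤ (offDiagonal⇒ offDiagonal))
      where
      mono = image-monomial x y z

  swap₁₂ : ∀ {n₁ n₂ n₃} → Tensor n₁ n₂ n₃ → Tensor n₂ n₁ n₃
  swap₁₂ T b a c = T a b c

  swap₂₃ : ∀ {n₁ n₂ n₃} → Tensor n₁ n₂ n₃ → Tensor n₁ n₃ n₂
  swap₂₃ T a c b = T a b c

  monomialRestriction-swap₁₂ : ∀ {n₁ n₂ n₃} {T : Tensor n₁ n₂ n₃} {s} →
                               MonomialRestriction (swap₁₂ T) s → MonomialRestriction T s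
  monomialRestriction-swap₁₂ {T = T} R = record
    { A = B ; B = A ; C = C
    ; unitEntries = λ x y z →
        UnitEntry-transport (λ (x≡y , y≡z) → sym x≡y , trans x≡y y≡z)
                            (λ (y≡x , x≡z) → sym y≡x , trans y≡x x≡z)
          (cong (ℕ._+ negExp C z) (ℕ.+-comm (negExp A y) (negExp B x)))
          (cong (ℕ._+ posExp C z) (ℕ.+-comm (posExp A y) (posExp B x)))
          (≈-trans (∑-comm λ a b → sum λ c → vector A y a * (vector B x b * (vector C z c * T b a c)))
                   (sum-cong-≋ λ b → sum-cong-≋ λ a → sum-cong-≋ λ c →
                     x∙yz≈y∙xz (vector A y a) (vector B x b) (vector C z c * T b a c)))
          (unitEntries y x z)
    }
    where open MonomialRestriction R

  monomialRestriction-swap₂₃ : ∀ {n₁ n₂ n₃} {T : Tensor n₁ n₂ n₃} {s} →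
                               MonomialRestriction (swap₂₃ T) s → MonomialRestriction T s
  monomialRestriction-swap₂₃ {T = T} R = record
    { A = A ; B = C ; C = B
    ; unitEntries = λ x y z →
        UnitEntry-transport (λ (x≡y , y≡z) → trans x≡y y≡z , sym y≡z)
                            (λ (x≡z , z≡y) → trans x≡z z≡y , sym z≡y)
          (xy∙z≈xz∙y (negExp A x) (negExp B z) (negExp C y))
          (xy∙z≈xz∙y (posExp A x) (posExp B z) (posExp C y))
          (sum-cong-≋ λ a →
            ≈-trans (∑-comm λ b c → vector A x a * (vector B z b * (vector C y c * T a c b)))
                    (sum-cong-≋ λ c → sum-cong-≋ λ b →
                      *-congˡ (x∙yz≈y∙xz (vector B z b) (vector C y c) (T a c b))))
          (unitEntries x z y)
    }
    where open MonomialRestriction R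

  δ : ∀ {n} → Fin n → Fin n → Carrier
  δ zero    zero    = 1#
  δ zero    (suc _) = 0#
  δ (suc _) zero    = 0#
  δ (suc a) (suc b) = δ a b

  sum-δ : ∀ {n} (a₀ : Fin n) (f : Fin n → Carrier) → sum (λ a → δ a a₀ * f a) ≈ f a₀
  sum-δ {suc n} zero f = begin
    1# * f zero + sum (λ a → 0# * f (suc a))
      ≈⟨ +-cong (*-identityˡ _) (≈-sym (*-distribˡ-sum 0# (f ∘ suc))) ⟩
    f zero + 0# * sum (f ∘ suc)
      ≈⟨ +-congˡ (zeroˡ _) ⟩
    f zero + 0#
      ≈⟨ +-identityʳ _ ⟩
    f zero
      ∎
  sum-δ {suc n} (suc a₀) f = ≈-trans (+-cong (zeroˡ _) (sum-δ a₀ (f ∘ suc))) (+-identityˡ _)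

  sum³-δδ : ∀ {n₁ n₂ n₃} (a₀ : Fin n₁) (b₀ : Fin n₂) (w : Fin n₃ → Carrier) (T : Tensor n₁ n₂ n₃) →
            (sum λ a → sum λ b → sum λ c → δ a a₀ * (δ b b₀ * (w c * T a b c))) ≈
            (sum λ c → w c * T a₀ b₀ c)
  sum³-δδ a₀ b₀ w T = begin
    (sum λ a → sum λ b → sum λ c → δ a a₀ * (δ b b₀ * (w c * T a b c)))
      ≈⟨ sum-cong-≋ (λ a → sum-cong-≋ λ b → factor (δ a a₀) (δ b b₀) λ c → w c * T a b c) ⟩
    (sum λ a → sum λ b → δ a a₀ * (δ b b₀ * sum λ c → w c * T a b c))
      ≈⟨ sum-cong-≋ (λ a → *-distribˡ-sum (δ a a₀) λ b → δ b b₀ * sum λ c → w c * T a b c) ⟨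
    (sum λ a → δ a a₀ * sum λ b → δ b b₀ * sum λ c → w c * T a b c)
      ≈⟨ sum-δ a₀ _ ⟩
    (sum λ b → δ b b₀ * sum λ c → w c * T a₀ b c)
      ≈⟨ sum-δ b₀ _ ⟩
    (sum λ c → w c * T a₀ b₀ c)
      ∎
    where
    factor : ∀ {n} x y (h : Fin n → Carrier) → sum (λ c → x * (y * h c)) ≈ x * (y * sum h)
    factor x y h =
      ≈-trans (≈-sym (*-distribˡ-sum x λ c → y * h c)) (*-congˡ (≈-sym (*-distribˡ-sum y h)))

  combine-<⇒<lex : ∀ {m n} {a a′ : Fin m} {b b′ : Fin n} →
                   combine a b Fin.< combine a′ b′ → (a , b) <lex (a′ , b′)
  combine-<⇒<lex {n = n} {a} {a′} {b} {b′} ab<a′b′ with Fin.<-cmp a a′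
  ... | tri< a<a′ _ _ = inj₁ a<a′
  ... | tri≈ _ refl _ =
    inj₂ (refl , ℕ.+-cancelˡ-< (n ℕ.* toℕ a) _ _
                   (subst₂ ℕ._<_ (Fin.toℕ-combine a b) (Fin.toℕ-combine a b′) ab<a′b′))
  ... | tri> _ _ a′<a = contradiction ab<a′b′ (ℕ.<-asym (Fin.combine-monoˡ-< b′ b a′<a))

  record PivotMatching {m₁ m₂ e} (gens : Fin e → Matrix m₁ m₂) : Set (c ⊔ ℓ) where
    field
      size          : ℕ
      row           : Fin size → Fin m₁
      col           : Fin size → Fin m₂
      row-injective : Injective _≡_ _≡_ row
      col-injective : Injective _≡_ _≡_ col
      matrix        : Fin size → Matrix m₁ m₂
      isPivot       : ∀ x → IsPivot (matrix x) (row x , col x)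
      inSpan        : ∀ x → InSpan gens (matrix x)

  module _ {m₁ m₂ e} {gens : Fin e → Matrix m₁ m₂} (B : PivotBasis gens) where
    open PivotBasis B

    PivotPair : Fin m₁ → Fin m₂ → Set
    PivotPair a b = InPivotSet B (a , b)

    pivotPair? : ∀ a b → Dec (PivotPair a b)
    pivotPair? a b = Fin.any? λ k → Product.≡-dec Fin._≟_ Fin._≟_ (pivot k) (a , b)

    open König PivotPair pivotPair? using (Matching)
    open Matching using (edges; within; disjoint)

    matchedPivots : Matching ⊤ ⊤ → PivotMatching gens
    matchedPivots M = record
      { size          = length (edges M)
      ; row           = proj₁ ∘ lookup (edges M)
      ; col           = proj₂ ∘ lookup (edges M)
      ; row-injective = lookup-injective proj₁ (AllPairs.map proj₁ (disjoint M))
      ; col-injective = lookup-injective proj₂ (AllPairs.map proj₂ (disjoint M))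
      ; matrix        = basis ∘ index
      ; isPivot       = λ x → subst (IsPivot (basis (index x))) (proj₂ (edgePivot x)) (isPivot (index x))
      ; inSpan        = proj₁ spans ∘ index
      }
      where
      edgePivot : ∀ x → PivotPair (proj₁ (lookup (edges M) x)) (proj₂ (lookup (edges M) x))
      edgePivot x = proj₂ (proj₂ (All.lookup (within M) (∈-lookup x)))
      index : Fin (length (edges M)) → Fin dim
      index = proj₁ ∘ edgePivot

  IsRho⇒pivotMatching : ∀ {m₁ m₂ e ρ} {gens : Fin e → Matrix m₁ m₂} → IsRho gens ρ →
                        Σ[ P ∈ PivotMatching gens ] ρ ≤ PivotMatching.size P
  IsRho⇒pivotMatching (B , _ , minimal)
    with M , S₁ , S₂ , cover , cover≤M ← König.König (PivotPair B) (pivotPair? B) =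
    matchedPivots B M , ℕ.≤-trans (minimal S₁ S₂ cover) cover≤M

  module _ {n₁ n₂ n₃} (T : Tensor n₁ n₂ n₃) (P : PivotMatching (slice zero (suc zero) T)) where
    open PivotMatching P

    pivotInverse : Fin size → Carrier
    pivotInverse z = proj₁ (inverse (matrix z (row z) (col z)) (proj₁ (isPivot z)))

    coefficient : Fin size → Fin n₃ → Carrier
    coefficient z = proj₁ (inSpan z)

    rank : Fin size → Fin size → ℕ
    rank x y = toℕ (combine (row x) (col y))

    normalised : Fin size → Fin size → Fin size → Carrier
    normalised x y z = pivotInverse z * matrix z (row x) (col y)

    pivotEntry : ∀ x y z → UnitEntry (Diagonal x y z) (rank z z) (rank x y) (normalised x y z)
    pivotEntry x y z = onDiagonal , offDiagonal
      where
      onDiagonal : Diagonal x y z → rank z z ≡ rank x y × normalised x y z ≈ 1#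
      onDiagonal (refl , refl) = refl , ≈-trans (*-comm _ _) (proj₂ (inverse _ _))
      offDiagonal : ¬ Diagonal x y z → rank z z ℕ.< rank x y ⊎ normalised x y z ≈ 0#
      offDiagonal ¬diagonal with Fin.<-cmp (combine (row x) (col y)) (combine (row z) (col z))
      ... | tri< before _ _ =
        inj₂ (≈-trans (*-congˡ (proj₂ (isPivot z) (row x) (col y) (combine-<⇒<lex before))) (zeroʳ _))
      ... | tri≈ _ same _ = contradiction (trans x≡z (sym y≡z) , y≡z) ¬diagonal
        where
        samePosition = Fin.combine-injective (row x) (col y) (row z) (col z) same
        x≡z = row-injective (proj₁ samePosition)
        y≡z = col-injective (proj₂ samePosition)
      ... | tri> _ _ after = inj₁ after

    pivotRestriction : MonomialRestriction T size
    pivotRestriction = record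
      { A = record { negExp = λ _ → 0 ; posExp = λ x → n₂ ℕ.* toℕ (row x) ; vector = λ x a → δ a (row x) }
      ; B = record { negExp = λ _ → 0 ; posExp = λ y → toℕ (col y) ; vector = λ y b → δ b (col y) }
      ; C = record { negExp = λ z → rank z z ; posExp = λ _ → 0
                   ; vector = λ z c → pivotInverse z * coefficient z c }
      ; unitEntries = λ x y z →
          UnitEntry-transport id id refl (exponent x y) (value x y z) (pivotEntry x y z)
      }
      where
      exponent : ∀ x y → rank x y ≡ n₂ ℕ.* toℕ (row x) ℕ.+ toℕ (col y) ℕ.+ 0
      exponent x y = trans (Fin.toℕ-combine (row x) (col y)) (sym (ℕ.+-identityʳ _))
      value : ∀ x y z → normalised x y z ≈
              (sum λ a → sum λ b → sum λ c →
                 δ a (row x) * (δ b (col y) * (pivotInverse z * coefficient z c * T a b c)))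
      value x y z = begin
        pivotInverse z * matrix z (row x) (col y)
          ≈⟨ *-congˡ (proj₂ (inSpan z) (row x) (col y)) ⟩
        pivotInverse z * (sum λ c → coefficient z c * T (row x) (col y) c)
          ≈⟨ *-distribˡ-sum (pivotInverse z) (λ c → coefficient z c * T (row x) (col y) c) ⟩
        (sum λ c → pivotInverse z * (coefficient z c * T (row x) (col y) c))
          ≈⟨ sum-cong-≋ (λ c → *-assoc (pivotInverse z) (coefficient z c) (T (row x) (col y) c)) ⟨
        (sum λ c → pivotInverse z * coefficient z c * T (row x) (col y) c)
          ≈⟨ sum³-δδ (row x) (col y) (λ c → pivotInverse z * coefficient z c) T ⟨
        (sum λ a → sum λ b → sum λ c →
           δ a (row x) * (δ b (col y) * (pivotInverse z * coefficient z c * T a b c)))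
          ∎

  slice₀₁-restriction : ∀ {n₁ n₂ n₃ ρ} {T : Tensor n₁ n₂ n₃} → IsRhoIJ zero (suc zero) T ρ →
                        Σ[ s ∈ ℕ ] ρ ≤ s × MonomialRestriction T s
  slice₀₁-restriction {T = T} isRho with P , ρ≤size ← IsRho⇒pivotMatching isRho =
    PivotMatching.size P , ρ≤size , pivotRestriction T P

theorem5p13 : ∀ {c ℓ} (F : Field c ℓ) {n₁ n₂ n₃ : ℕ}
                (T : FieldDefs.Tensor F n₁ n₂ n₃) (i j : Fin 3) → i ≢ j →
                (ρ q : ℕ) → FieldDefs.IsRhoIJ F i j T ρ →
                FieldDefs.IsBorderSubrank F T q → ρ ≤ q
theorem5p13 F T i j i≢j ρ q isRho (_ , maximal) = bySlicing i j i≢j isRho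
  where
  open FieldDefs F using (Tensor; IsRhoIJ)
  viaSlicing₀₁ : ∀ {m₁ m₂ m₃} {T′ : Tensor m₁ m₂ m₃} →
                 (∀ {s} → MonomialRestriction F T′ s → MonomialRestriction F T s) →
                 IsRhoIJ zero (suc zero) T′ ρ → ρ ≤ q
  viaSlicing₀₁ transport isRho′ with s , ρ≤s , R ← slice₀₁-restriction F isRho′ =
    ≤-trans ρ≤s (maximal s (monomialRestriction⇒borderRestricts F (transport R)))
  bySlicing : ∀ i j → i ≢ j → IsRhoIJ i j T ρ → ρ ≤ q
  bySlicing zero             (suc zero)       _ = viaSlicing₀₁ id
  bySlicing (suc zero)       zero             _ = viaSlicing₀₁ (monomialRestriction-swap₁₂ F)
  bySlicing zero             (suc (suc zero)) _ = viaSlicing₀₁ (monomialRestriction-swap₂₃ F)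
  bySlicing (suc (suc zero)) zero             _ =
    viaSlicing₀₁ (monomialRestriction-swap₂₃ F ∘ monomialRestriction-swap₁₂ F)
  bySlicing (suc zero)       (suc (suc zero)) _ =
    viaSlicing₀₁ (monomialRestriction-swap₁₂ F ∘ monomialRestriction-swap₂₃ F)
  bySlicing (suc (suc zero)) (suc zero)       _ =
    viaSlicing₀₁ (monomialRestriction-swap₁₂ F ∘ monomialRestriction-swap₂₃ F ∘ monomialRestriction-swap₁₂ F)
  bySlicing zero             zero             i≢i = contradiction refl i≢i
  bySlicing (suc zero)       (suc zero)       i≢i = contradiction refl i≢i
  bySlicing (suc (suc zero)) (suc (suc zero)) i≢i = contradiction refl i≢i
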